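{- Let $M$ be a square $\{0,1\}$-matrix with exactly $k$ diagonal entries equal to $0$ and exactly $\ell$ diagonal entries equal to $1$, and let $D$ be a minimal $M$-obstruction. If $k=1$ and there exists a pair of true twins in $D$, then $|V(D)|\le 2(\ell+1)$. Similarly, if $\ell=1$ and there exists a pair of false twins in $D$, then $|V(D)|\le 2(k+1)$.
   Context: Digraphs are finite, without loops and multiple arcs. A strong clique: set $C$ with both $(x,y),(y,x)$ arcs for all distinct $x,y\in C$; an independent set: set with no arcs between any two of its vertices. For disjoint $S,S'$, $S$ is completely adjacent (resp. completely non-adjacent) to $S'$ if $(x,x')$ is an arc for all (resp. no) $x\in S,x'\in S'$. An $M$-partition of $D$ ($M$ of size $k+\ell$) is a partition of $V(D)$ into possibly empty parts $V_1,\dots,V_{k+\ell}$ with $V_i$ independent if $M(i,i)=0$, a strong clique if $M(i,i)=1$, and for $i\ne j$, $V_i$ completely non-adjacent to $V_j$ if $M(i,j)=0$ and completely adjacent to $V_j$ if $M(i,j)=1$. A minimal $M$-obstruction is a digraph with no $M$-partition such that $D-v$ has an $M$-partition for every vertex $v$. For distinct vertices $u,v,w$, $w$ distinguishes $u,v$ if exactly one of $u,v$ is an in-neighbour of $w$ or exactly one is an out-neighbour of $w$; distinct $u,v$ are twins if no vertex distinguishes them; true twins if moreover both $(u,v),(v,u)$ are arcs, false twins if neither is an arc. -}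

module Defs where

open import Data.Nat using (ℕ; zero; suc; _+_)
open import Data.Fin using (Fin; zero; suc; punchIn)
open import Data.Bool using (Bool; true; false)
open import Data.Product using (Σ; _×_; ∃-syntax)
open import Relation.Binary.PropositionalEquality using (_≡_; _≢_)
open import Relation.Nullary using (¬_)

record Digraph (n : ℕ) : Set where
  field
    arc      : Fin n → Fin n → Bool
    loopless : ∀ x → arc x x ≡ false
open Digraph public

Matrix : ℕ → Set
Matrix m = Fin m → Fin m → Bool

countFin : ∀ {m} → (Fin m → Bool) → Bool → ℕ
countFin {zero}  f b = 0
countFin {suc m} f true  with f zero
... | true  = suc (countFin (λ i → f (suc i)) true)
... | false = countFin (λ i → f (suc i)) true
countFin {suc m} f false with f zero
... | true  = countFin (λ i → f (suc i)) false
... | false = suc (countFin (λ i → f (suc i)) false)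

diagZeros : ∀ {m} → Matrix m → ℕ
diagZeros M = countFin (λ i → M i i) false

diagOnes : ∀ {m} → Matrix m → ℕ
diagOnes M = countFin (λ i → M i i) true

-- For distinct x, y: (x,y) is an arc iff M (p x) (p y) = 1. For p x = p y = i this
-- says V_i is independent (M i i = 0) or a strong clique (M i i = 1); for p x ≠ p y it
-- says V_{p x} is completely non-adjacent / completely adjacent to V_{p y}.
IsMPartition : ∀ {m n} → Matrix m → Digraph n → (Fin n → Fin m) → Set
IsMPartition M D p = ∀ x y → x ≢ y → arc D x y ≡ M (p x) (p y)

HasMPartition : ∀ {m n} → Matrix m → Digraph n → Set
HasMPartition {m} {n} M D = Σ (Fin n → Fin m) (IsMPartition M D)

deleteVertex : ∀ {n} → Digraph (suc n) → Fin (suc n) → Digraph n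
deleteVertex D v = record
  { arc      = λ x y → arc D (punchIn v x) (punchIn v y)
  ; loopless = λ x → loopless D (punchIn v x)
  }

MinimalObstruction : ∀ {m n} → Matrix m → Digraph n → Set
MinimalObstruction {n = zero}  M D = ¬ HasMPartition M D
MinimalObstruction {n = suc n} M D =
  ¬ HasMPartition M D × (∀ v → HasMPartition M (deleteVertex D v))

Distinguishes : ∀ {n} → Digraph n → Fin n → Fin n → Fin n → Set
Distinguishes D w u v = (arc D u w ≢ arc D v w) Data.Sum.⊎ (arc D w u ≢ arc D w v)
  where import Data.Sum

Twins : ∀ {n} → Digraph n → Fin n → Fin n → Set
Twins D u v = u ≢ v × (∀ w → w ≢ u → w ≢ v → ¬ Distinguishes D w u v)

TrueTwins : ∀ {n} → Digraph n → Fin n → Fin n → Set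
TrueTwins D u v = Twins D u v × arc D u v ≡ true × arc D v u ≡ true

FalseTwins : ∀ {n} → Digraph n → Fin n → Fin n → Set
FalseTwins D u v = Twins D u v × arc D u v ≡ false × arc D v u ≡ false

-- Complementing D and M swaps independent parts with strong cliques and false twins with true twins,
-- so it suffices to bound n when M has a single independent part o and D has true twins u, v.
-- By minimality every D − x has an M-partition; x cannot join the part of a true twin, so that twin
-- lies in o. In such a partition, two vertices of a common clique ("looped") part are true twins,
-- so a clique part holds at most two vertices. If the twin of x is alone in o, coding the first vertex
-- of each part by its part, and x and the second vertices of clique parts by their parts in a second
-- copy of the ℓ + 1 parts, gives n ≤ 2(ℓ + 1). Otherwise, in the partition p of D − u, o contains a
-- third vertex w, and a partition r of D − w gives a similar coding: the vertices of o are false twins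
-- of w, so they lie in clique parts of r, and each second vertex of a clique part of p is replaced by
-- whichever of itself and its true twin lies in a clique part of r. When that vertex shares its part
-- of r with u or v, it and its twin play the role of x and its twin above.

module Submission where

open import Defs
open import Data.Bool using (Bool; true; false; not; if_then_else_)
open import Data.Bool.Properties using (not-injective; ¬-not; not-¬) renaming (_≟_ to _≟ᵇ_)
open import Data.Empty using (⊥; ⊥-elim)
open import Data.Fin using (Fin; zero; suc; punchIn; punchOut; _≟_; join; splitAt; _<_)
open import Data.Fin.Properties using (punchIn-punchOut; punchOut-cong; punchIn-injective; injective⇒≤; splitAt-join; any?; <-cmp; _<?_; <⇒≢; <-trans)
open import Data.Nat using (ℕ; zero; suc; _+_; _*_; _≤_)
open import Data.Nat.Properties using (+-suc; 1+n≢0; m+n≡0⇒n≡0; suc-injective; ≤-trans; ≤-reflexive; +-identityʳ)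
open import Data.Product using (Σ; _×_; _,_; proj₁; proj₂; ∃-syntax)
open import Data.Sum using (_⊎_; inj₁; inj₂; [_,_]′)
open import Data.Sum.Properties using (inj₁-injective; inj₂-injective)
open import Function using (_∘_)
open import Relation.Binary.PropositionalEquality using (_≡_; _≢_; ≢-sym; refl; sym; trans; cong; cong₂; subst; module ≡-Reasoning)
open import Relation.Binary using (tri<; tri≈; tri>)
open import Relation.Nullary using (¬_; yes; no; Dec; does)
open import Relation.Nullary.Decidable using (decidable-stable; dec-true; dec-false; _×-dec_; ¬?)

private
  variable
    m n : ℕ

module _ (D : Digraph n) where

  -- The positive form of ¬ Distinguishes D t c d.
  Agrees : Fin n → Fin n → Fin n → Set
  Agrees t c d = arc D c t ≡ arc D d t × arc D t c ≡ arc D t d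

  agrees⇒twins : ∀ {c d} → c ≢ d → (∀ t → t ≢ c → t ≢ d → Agrees t c d) → Twins D c d
  agrees⇒twins c≢d agree = c≢d , λ where
    t t≢c t≢d (inj₁ ne) → ne (proj₁ (agree t t≢c t≢d))
    t t≢c t≢d (inj₂ ne) → ne (proj₂ (agree t t≢c t≢d))

  twins⇒agrees : ∀ {c d t} → Twins D c d → t ≢ c → t ≢ d → Agrees t c d
  twins⇒agrees (_ , twin) t≢c t≢d =
    decidable-stable (_ ≟ᵇ _) (twin _ t≢c t≢d ∘ inj₁) ,
    decidable-stable (_ ≟ᵇ _) (twin _ t≢c t≢d ∘ inj₂)

  trueTwins-sym : ∀ {c d} → TrueTwins D c d → TrueTwins D d c
  trueTwins-sym ((c≢d , twin) , cd , dc) = (≢-sym c≢d , λ t t≢d t≢c → twin t t≢c t≢d ∘ swap) , dc , cd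
    where
    swap : ∀ {t} → Distinguishes D t _ _ → Distinguishes D t _ _
    swap (inj₁ ne) = inj₁ (ne ∘ sym)
    swap (inj₂ ne) = inj₂ (ne ∘ sym)

  agrees-transfer : ∀ {x y a b} → Agrees a x y → Agrees b x y → Agrees y a b → Agrees x a b
  agrees-transfer (xa≡ya , ax≡ay) (xb≡yb , bx≡by) (ay≡by , ya≡yb) =
    trans ax≡ay (trans ay≡by (sym bx≡by)) , trans xa≡ya (trans ya≡yb (sym xb≡yb))

-- q is an M-partition of D − x; the part q x assigned to x itself is ignored.
record IsMPartitionWithout (M : Matrix m) (D : Digraph n) (x : Fin n) (q : Fin n → Fin m) : Set where
  constructor mkPartitionWithout
  field
    arc≡M : ∀ a b → a ≢ x → b ≢ x → a ≢ b → arc D a b ≡ M (q a) (q b)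
open IsMPartitionWithout public

module _ {M : Matrix m} {D : Digraph (suc n)} {x : Fin (suc n)} where

  partitionWithout : Fin m → HasMPartition M (deleteVertex D x) →
                     Σ (Fin (suc n) → Fin m) (IsMPartitionWithout M D x)
  partitionWithout default (p , p-part) = q , mkPartitionWithout q-arc
    where
    q : Fin (suc n) → Fin m
    q a with x ≟ a
    ... | yes _   = default
    ... | no x≢a = p (punchOut x≢a)

    q-punchOut : ∀ {a} (x≢a : x ≢ a) → q a ≡ p (punchOut x≢a)
    q-punchOut {a} x≢a with x ≟ a
    ... | yes x≡a = ⊥-elim (x≢a x≡a)
    ... | no _    = cong p (punchOut-cong x refl)

    q-arc : ∀ a b → a ≢ x → b ≢ x → a ≢ b → arc D a b ≡ M (q a) (q b)
    q-arc a b a≢x b≢x a≢b = begin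
      arc D a b                            ≡⟨ cong₂ (arc D) (sym (punchIn-punchOut x≢a)) (sym (punchIn-punchOut x≢b)) ⟩
      arc D (punchIn x a′) (punchIn x b′)  ≡⟨ p-part a′ b′ (a≢b ∘ punchOut-injective) ⟩
      M (p a′) (p b′)                      ≡⟨ sym (cong₂ M (q-punchOut x≢a) (q-punchOut x≢b)) ⟩
      M (q a) (q b)                        ∎
      where
      open ≡-Reasoning
      x≢a : x ≢ a
      x≢a = ≢-sym a≢x
      x≢b : x ≢ b
      x≢b = ≢-sym b≢x
      a′ b′ : Fin n
      a′ = punchOut x≢a
      b′ = punchOut x≢b
      punchOut-injective : a′ ≡ b′ → a ≡ b
      punchOut-injective a′≡b′ =
        trans (sym (punchIn-punchOut x≢a)) (trans (cong (punchIn x) a′≡b′) (punchIn-punchOut x≢b))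

module _ {M : Matrix m} {D : Digraph n} {x : Fin n} where

  extendPartition : ∀ {q} → IsMPartitionWithout M D x q → (c : Fin m) →
                    (∀ b → b ≢ x → arc D x b ≡ M c (q b)) → (∀ b → b ≢ x → arc D b x ≡ M (q b) c) →
                    HasMPartition M D
  extendPartition {q} q-part c out in′ = q′ , q′-part
    where
    q′ : Fin n → Fin m
    q′ a with a ≟ x
    ... | yes _ = c
    ... | no _  = q a

    q′-part : IsMPartition M D q′
    q′-part a b a≢b with a ≟ x | b ≟ x
    ... | yes refl | yes refl = ⊥-elim (a≢b refl)
    ... | yes refl | no b≢x   = out b b≢x
    ... | no a≢x   | yes refl = in′ a a≢x
    ... | no a≢x   | no b≢x   = arc≡M q-part a b a≢x b≢x a≢b

module _ {M : Matrix m} {D : Digraph n} {x : Fin n} {q : Fin n → Fin m}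
         (q-part : IsMPartitionWithout M D x q) where

  samePart-agrees : ∀ {t c d} → t ≢ x → c ≢ x → d ≢ x → t ≢ c → t ≢ d → q c ≡ q d → Agrees D t c d
  samePart-agrees {t} t≢x c≢x d≢x t≢c t≢d qc≡qd =
    trans (arc≡M q-part _ t c≢x t≢x (≢-sym t≢c))
      (trans (cong (λ i → M i (q t)) qc≡qd) (sym (arc≡M q-part _ t d≢x t≢x (≢-sym t≢d)))) ,
    trans (arc≡M q-part t _ t≢x c≢x t≢c)
      (trans (cong (M (q t)) qc≡qd) (sym (arc≡M q-part t _ t≢x d≢x t≢d)))

  samePart-arc : ∀ {a b} → a ≢ x → b ≢ x → a ≢ b → q a ≡ q b → arc D a b ≡ M (q a) (q a)
  samePart-arc {a} a≢x b≢x a≢b qa≡qb = trans (arc≡M q-part a _ a≢x b≢x a≢b) (cong (M (q a)) (sym qa≡qb))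

  -- y stands in for the deleted vertex x: it sees a and b as x does.
  samePart-twins : ∀ {y a b} → y ≢ x → a ≢ x → b ≢ x → a ≢ y → b ≢ y → a ≢ b → q a ≡ q b →
                   Agrees D a x y → Agrees D b x y → Twins D a b
  samePart-twins {a = a} {b} y≢x a≢x b≢x a≢y b≢y a≢b qa≡qb a-agrees b-agrees = agrees⇒twins D a≢b agree
    where
    agree : ∀ t → t ≢ a → t ≢ b → Agrees D t a b
    agree t t≢a t≢b with t ≟ x
    ... | yes refl = agrees-transfer D a-agrees b-agrees
                       (samePart-agrees y≢x a≢x b≢x (≢-sym a≢y) (≢-sym b≢y) qa≡qb)
    ... | no t≢x  = samePart-agrees t≢x a≢x b≢x t≢a t≢b qa≡qb

  samePart-trueTwins : ∀ {y a b} → y ≢ x → a ≢ x → b ≢ x → a ≢ y → b ≢ y → a ≢ b → q a ≡ q b →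
                       M (q a) (q a) ≡ true → Agrees D a x y → Agrees D b x y → TrueTwins D a b
  samePart-trueTwins y≢x a≢x b≢x a≢y b≢y a≢b qa≡qb looped a-agrees b-agrees =
    samePart-twins y≢x a≢x b≢x a≢y b≢y a≢b qa≡qb a-agrees b-agrees ,
    trans (samePart-arc a≢x b≢x a≢b qa≡qb) looped ,
    trans (samePart-arc b≢x a≢x (≢-sym a≢b) (sym qa≡qb)) (trans (cong (λ i → M i i) (sym qa≡qb)) looped)

  -- Otherwise x could join the part of its twin y.
  twinPart-diag≢arc : ∀ {y} → ¬ HasMPartition M D → Twins D x y → arc D x y ≡ arc D y x →
                      M (q y) (q y) ≢ arc D x y
  twinPart-diag≢arc {y} no-partition twins symmetric diag≡arc =
    no-partition (extendPartition q-part (q y) out in′)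
    where
    out : ∀ b → b ≢ x → arc D x b ≡ M (q y) (q b)
    out b b≢x with b ≟ y
    ... | yes refl = sym diag≡arc
    ... | no b≢y  = trans (proj₁ (twins⇒agrees D twins b≢x b≢y))
                          (arc≡M q-part y b (≢-sym (proj₁ twins)) b≢x (≢-sym b≢y))
    in′ : ∀ b → b ≢ x → arc D b x ≡ M (q b) (q y)
    in′ b b≢x with b ≟ y
    ... | yes refl = trans (sym symmetric) (sym diag≡arc)
    ... | no b≢y  = trans (proj₂ (twins⇒agrees D twins b≢x b≢y))
                          (arc≡M q-part b y b≢x (≢-sym (proj₁ twins)) b≢y)

≤-fromClassification : ∀ {N} (A B : Fin N → Set) → (∀ z → A z ⊎ B z) →
                       (f : ∀ {z} → A z → Fin m) (g : ∀ {z} → B z → Fin m) →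
                       (∀ {a b} (α : A a) (β : A b) → f α ≡ f β → a ≡ b) →
                       (∀ {a b} (α : B a) (β : B b) → g α ≡ g β → a ≡ b) →
                       N ≤ m + m
≤-fromClassification {m} A B classify f g f-injective g-injective =
  injective⇒≤ {f = join m m ∘ code ∘ classify} λ e →
    code-injective (classify _) (classify _)
      (trans (sym (splitAt-join m m _)) (trans (cong (splitAt m) e) (splitAt-join m m _)))
  where
  code : ∀ {z} → A z ⊎ B z → Fin m ⊎ Fin m
  code = [ inj₁ ∘ f , inj₂ ∘ g ]′
  code-injective : ∀ {a b} (s : A a ⊎ B a) (t : A b ⊎ B b) → code s ≡ code t → a ≡ b
  code-injective (inj₁ α) (inj₁ β) e = f-injective α β (inj₁-injective e)
  code-injective (inj₂ α) (inj₂ β) e = g-injective α β (inj₂-injective e)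
  code-injective (inj₁ _) (inj₂ _) ()
  code-injective (inj₂ _) (inj₁ _) ()

indicator : Bool → Bool → ℕ
indicator a b = if does (a ≟ᵇ b) then 1 else 0

countFin-suc : ∀ (f : Fin (suc m) → Bool) b → countFin f b ≡ indicator (f zero) b + countFin (f ∘ suc) b
countFin-suc f true  with f zero
... | true  = refl
... | false = refl
countFin-suc f false with f zero
... | true  = refl
... | false = refl

indicator-≡ : ∀ {a b} → a ≡ b → indicator a b ≡ 1
indicator-≡ {a} {b} a≡b = cong (if_then 1 else 0) (dec-true (a ≟ᵇ b) a≡b)

indicator-≢ : ∀ {a b} → a ≢ b → indicator a b ≡ 0
indicator-≢ {a} {b} a≢b = cong (if_then 1 else 0) (dec-false (a ≟ᵇ b) a≢b)

countFin-not : ∀ (f : Fin m → Bool) b → countFin (not ∘ f) b ≡ countFin f (not b)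
countFin-not {zero}  f b = refl
countFin-not {suc m} f b = begin
  countFin (not ∘ f) b                                       ≡⟨ countFin-suc (not ∘ f) b ⟩
  indicator (not (f zero)) b + countFin (not ∘ f ∘ suc) b    ≡⟨ cong₂ _+_ (indicator-not (f zero) b) (countFin-not (f ∘ suc) b) ⟩
  indicator (f zero) (not b) + countFin (f ∘ suc) (not b)    ≡⟨ sym (countFin-suc f (not b)) ⟩
  countFin f (not b)                                         ∎
  where
  open ≡-Reasoning
  indicator-not : ∀ a b → indicator (not a) b ≡ indicator a (not b)
  indicator-not false false = refl
  indicator-not false true  = refl
  indicator-not true  false = refl
  indicator-not true  true  = refl

countFin-total : ∀ (f : Fin m → Bool) → countFin f true + countFin f false ≡ m
countFin-total {zero}  f = refl
countFin-total {suc m} f =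
  trans (cong₂ _+_ (countFin-suc f true) (countFin-suc f false)) (split (f zero))
  where
  split : ∀ a → (indicator a true + countFin (f ∘ suc) true) + (indicator a false + countFin (f ∘ suc) false)
                ≡ suc m
  split true  = cong suc (countFin-total (f ∘ suc))
  split false = trans (+-suc _ _) (cong suc (countFin-total (f ∘ suc)))

countFin-tail : ∀ (f : Fin (suc m) → Bool) {b c} → indicator (f zero) b ≡ c →
                countFin f b ≡ c + countFin (f ∘ suc) b
countFin-tail f {b} head≡c = trans (countFin-suc f b) (cong (_+ countFin (f ∘ suc) b) head≡c)

countFin-zero : ∀ (f : Fin m → Bool) b → countFin f b ≡ 0 → ∀ i → f i ≢ b
countFin-zero {suc m} f b none zero    f0≡b = 1+n≢0 (trans (sym (countFin-tail f (indicator-≡ f0≡b))) none)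
countFin-zero {suc m} f b none (suc i) fi≡b =
  countFin-zero (f ∘ suc) b (m+n≡0⇒n≡0 (indicator (f zero) b) (trans (sym (countFin-suc f b)) none)) i fi≡b

countFin-one : ∀ (f : Fin m → Bool) b → countFin f b ≡ 1 → Σ (Fin m) λ i → f i ≡ b × (∀ j → f j ≡ b → j ≡ i)
countFin-one {suc m} f b one with f zero ≟ᵇ b
... | yes f0≡b = zero , f0≡b , unique
  where
  tail-empty : countFin (f ∘ suc) b ≡ 0
  tail-empty = suc-injective (trans (sym (countFin-tail f (indicator-≡ f0≡b))) one)
  unique : ∀ j → f j ≡ b → j ≡ zero
  unique zero    _    = refl
  unique (suc j) fj≡b = ⊥-elim (countFin-zero (f ∘ suc) b tail-empty j fj≡b)
... | no f0≢b with countFin-one (f ∘ suc) b (trans (sym (countFin-tail f (indicator-≢ f0≢b))) one)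
...   | i , fi≡b , unique = suc i , fi≡b , λ where
  zero    f0≡b → ⊥-elim (f0≢b f0≡b)
  (suc j) fj≡b → cong suc (unique j fj≡b)

Follower : ∀ {N} → Fin N → (Fin N → Fin m) → Fin N → Set
Follower x q z = ∃[ t ] t < z × t ≢ x × q t ≡ q z

follower? : ∀ {N} (x : Fin N) (q : Fin N → Fin m) z → Dec (Follower x q z)
follower? x q z = any? λ t → (t <? z) ×-dec (¬? (t ≟ x)) ×-dec (q t ≟ q z)

leaders-injective : ∀ {N} {x : Fin N} {q : Fin N → Fin m} {a b} → a ≢ x → b ≢ x →
                    ¬ Follower x q a → ¬ Follower x q b → q a ≡ q b → a ≡ b
leaders-injective {a = a} {b} a≢x b≢x a-leads b-leads qa≡qb with <-cmp a b
... | tri< a<b _ _ = ⊥-elim (b-leads (a , a<b , a≢x , qa≡qb))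
... | tri≈ _ a≡b _ = a≡b
... | tri> _ _ b<a = ⊥-elim (a-leads (b , b<a , b≢x , sym qa≡qb))

module OneIndependentPart {N} (M : Matrix m) (D : Digraph N) (no-partition : ¬ HasMPartition M D)
  (minimality : ∀ x → Σ (Fin N → Fin m) (IsMPartitionWithout M D x))
  (o : Fin m) (o-independent : M o o ≡ false) (o-unique : ∀ i → M i i ≡ false → i ≡ o) where

  looped≢o : ∀ {i} → M i i ≡ true → i ≢ o
  looped≢o looped refl with trans (sym looped) o-independent
  ... | ()

  ≢o⇒looped : ∀ {i} → i ≢ o → M i i ≡ true
  ≢o⇒looped {i} i≢o = ¬-not (i≢o ∘ o-unique i)

  adjacent-looped : ∀ {x q a b} → IsMPartitionWithout M D x q → a ≢ x → b ≢ x → a ≢ b →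
                    arc D a b ≡ true → M (q a) (q a) ≡ false → M (q b) (q b) ≡ true
  adjacent-looped {q = q} {a} {b} q-part a≢x b≢x a≢b ab qa-independent = ¬-not λ qb-independent →
    not-¬ ab (trans (arc≡M q-part a b a≢x b≢x a≢b)
      (trans (cong₂ M (o-unique _ qa-independent) (o-unique _ qb-independent)) o-independent))

  trueTwin-part : ∀ {x y q} → IsMPartitionWithout M D x q → TrueTwins D x y → q y ≡ o
  trueTwin-part q-part (twins , xy , yx) =
    o-unique _ (¬-not (subst (_ ≢_) xy (twinPart-diag≢arc q-part no-partition twins (trans xy (sym yx)))))

  falseTwin-looped : ∀ {x y q} → IsMPartitionWithout M D x q → FalseTwins D x y → M (q y) (q y) ≡ true
  falseTwin-looped q-part (twins , xy , yx) =
    ¬-not (subst (_ ≢_) xy (twinPart-diag≢arc q-part no-partition twins (trans xy (sym yx))))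

  commonTrueTwin⇒nonadjacent : ∀ {c a b} → TrueTwins D c a → TrueTwins D c b → a ≢ b → arc D a b ≡ false
  commonTrueTwin⇒nonadjacent {c} ca cb a≢b with minimality c
  ... | q , q-part = trans (arc≡M q-part _ _ (≢-sym (proj₁ (proj₁ ca))) (≢-sym (proj₁ (proj₁ cb))) a≢b)
                       (trans (cong₂ M (trueTwin-part q-part ca) (trueTwin-part q-part cb)) o-independent)

  module _ {x y q} (q-part : IsMPartitionWithout M D x q) (xy-twins : TrueTwins D x y) where

    private
      y≢x : y ≢ x
      y≢x = ≢-sym (proj₁ (proj₁ xy-twins))

      qy≡o : q y ≡ o
      qy≡o = trueTwin-part q-part xy-twins

      looped⇒≢y : ∀ {a} → M (q a) (q a) ≡ true → a ≢ y
      looped⇒≢y looped refl = looped≢o looped qy≡o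

    loopedPart-trueTwins : ∀ {a b} → a ≢ x → b ≢ x → a ≢ b → q a ≡ q b → M (q a) (q a) ≡ true → TrueTwins D a b
    loopedPart-trueTwins a≢x b≢x a≢b qa≡qb looped =
      samePart-trueTwins q-part y≢x a≢x b≢x a≢y b≢y a≢b qa≡qb looped
        (twins⇒agrees D (proj₁ xy-twins) a≢x a≢y) (twins⇒agrees D (proj₁ xy-twins) b≢x b≢y)
      where
      a≢y : _ ≢ y
      a≢y = looped⇒≢y looped
      b≢y : _ ≢ y
      b≢y = looped⇒≢y (trans (cong (λ i → M i i) (sym qa≡qb)) looped)

    -- Two of the three would be common true twins of the third, yet adjacent.
    loopedPart-atMostTwo : ∀ {a b c} → a ≢ x → b ≢ x → c ≢ x → a ≢ b → a ≢ c → b ≢ c →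
                           q a ≡ q b → q a ≡ q c → M (q a) (q a) ≡ true → ⊥
    loopedPart-atMostTwo a≢x b≢x c≢x a≢b a≢c b≢c qa≡qb qa≡qc looped =
      not-¬ (trans (samePart-arc q-part b≢x c≢x b≢c (trans (sym qa≡qb) qa≡qc))
                   (trans (cong (λ i → M i i) (sym qa≡qb)) looped))
            (commonTrueTwin⇒nonadjacent (loopedPart-trueTwins a≢x b≢x a≢b qa≡qb looped)
                                        (loopedPart-trueTwins a≢x c≢x a≢c qa≡qc looped) b≢c)

    private
      follower-precedes : ∀ {c d} → c ≢ x → d ≢ x → Follower x q c → c < d → q c ≡ q d →
                          M (q c) (q c) ≡ true → ⊥
      follower-precedes c≢x d≢x (t , t<c , t≢x , qt≡qc) c<d qc≡qd looped =
        loopedPart-atMostTwo t≢x c≢x d≢x (<⇒≢ t<c) (<⇒≢ (<-trans t<c c<d)) (<⇒≢ c<d)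
          qt≡qc (trans qt≡qc qc≡qd) (trans (cong (λ i → M i i) qt≡qc) looped)

    loopedFollowers-injective : ∀ {a b} → a ≢ x → b ≢ x → Follower x q a → Follower x q b →
                                q a ≡ q b → M (q a) (q a) ≡ true → a ≡ b
    loopedFollowers-injective {a} {b} a≢x b≢x a-follows b-follows qa≡qb looped with <-cmp a b
    ... | tri< a<b _ _ = ⊥-elim (follower-precedes a≢x b≢x a-follows a<b qa≡qb looped)
    ... | tri≈ _ a≡b _ = a≡b
    ... | tri> _ _ b<a = ⊥-elim (follower-precedes b≢x a≢x b-follows b<a (sym qa≡qb)
                                   (trans (cong (λ i → M i i) (sym qa≡qb)) looped))

    -- Leaders go injectively to their parts; followers to their (looped) parts in a second copy of Fin m,
    -- where x takes the part o that no follower can occupy.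
    ≤-fromTrueTwins : (∀ z → z ≢ x → z ≢ y → q z ≢ o) → N ≤ m + m
    ≤-fromTrueTwins only-y-in-o =
      ≤-fromClassification Leader Other classify (λ {z} _ → q z) other-part
        (λ (a≢x , a-leads) (b≢x , b-leads) → leaders-injective a≢x b≢x a-leads b-leads) other-injective
      where
      Leader Other : Fin N → Set
      Leader z = z ≢ x × ¬ Follower x q z
      Other  z = z ≡ x ⊎ (z ≢ x × Follower x q z)

      classify : ∀ z → Leader z ⊎ Other z
      classify z with z ≟ x | follower? x q z
      ... | yes z≡x | _          = inj₂ (inj₁ z≡x)
      ... | no z≢x  | yes follows = inj₂ (inj₂ (z≢x , follows))
      ... | no z≢x  | no leads    = inj₁ (z≢x , leads)

      other-part : ∀ {z} → Other z → Fin m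
      other-part     (inj₁ _) = o
      other-part {z} (inj₂ _) = q z

      follower≢o : ∀ {z} → z ≢ x → Follower x q z → q z ≢ o
      follower≢o {z} z≢x (t , t<z , t≢x , qt≡qz) qz≡o with z ≟ y
      ... | no z≢y  = only-y-in-o z z≢x z≢y qz≡o
      ... | yes refl = only-y-in-o t t≢x (<⇒≢ t<z) (trans qt≡qz qz≡o)

      other-injective : ∀ {a b} (α : Other a) (β : Other b) → other-part α ≡ other-part β → a ≡ b
      other-injective (inj₁ refl)          (inj₁ refl)          _     = refl
      other-injective (inj₁ _)             (inj₂ (b≢x , b-fol)) o≡qb  = ⊥-elim (follower≢o b≢x b-fol (sym o≡qb))
      other-injective (inj₂ (a≢x , a-fol)) (inj₁ _)             qa≡o  = ⊥-elim (follower≢o a≢x a-fol qa≡o)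
      other-injective (inj₂ (a≢x , a-fol)) (inj₂ (b≢x , b-fol)) qa≡qb =
        loopedFollowers-injective a≢x b≢x a-fol b-fol qa≡qb (≢o⇒looped (follower≢o a≢x a-fol))

  module TwinPair {u v} (uv-twins : TrueTwins D u v) where

    IsUV : Fin N → Set
    IsUV t = t ≡ u ⊎ t ≡ v

    uv-same : ∀ {A : Set} (g : Fin N → A) → g u ≡ g v → ∀ {t t′} → IsUV t → IsUV t′ → g t ≡ g t′
    uv-same g gu≡gv (inj₁ refl) (inj₁ refl) = refl
    uv-same g gu≡gv (inj₁ refl) (inj₂ refl) = gu≡gv
    uv-same g gu≡gv (inj₂ refl) (inj₁ refl) = sym gu≡gv
    uv-same g gu≡gv (inj₂ refl) (inj₂ refl) = refl

    private
      u≢v : u ≢ v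
      u≢v = proj₁ (proj₁ uv-twins)

      v≢u : v ≢ u
      v≢u = ≢-sym u≢v

      uv-agree : ∀ {z} → z ≢ u → z ≢ v → Agrees D z u v
      uv-agree = twins⇒agrees D (proj₁ uv-twins)

    p : Fin N → Fin m
    p = proj₁ (minimality u)

    p-part : IsMPartitionWithout M D u p
    p-part = proj₂ (minimality u)

    pv≡o : p v ≡ o
    pv≡o = trueTwin-part p-part uv-twins

    InO InLooped : Fin N → Set
    InO      z = z ≢ u × z ≢ v × p z ≡ o
    InLooped z = z ≢ u × p z ≢ o

    inO? : ∀ z → Dec (InO z)
    inO? z = ¬? (z ≟ u) ×-dec ¬? (z ≟ v) ×-dec (p z ≟ o)

    inLooped≢v : ∀ {z} → InLooped z → z ≢ v
    inLooped≢v (_ , pz≢o) refl = pz≢o pv≡o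

    uv≢ : ∀ {t z} → IsUV t → z ≢ u → z ≢ v → t ≢ z
    uv≢ (inj₁ refl) z≢u _ = ≢-sym z≢u
    uv≢ (inj₂ refl) _ z≢v = ≢-sym z≢v

    uv≢inO : ∀ {t z} → IsUV t → InO z → t ≢ z
    uv≢inO t-uv (z≢u , z≢v , _) = uv≢ t-uv z≢u z≢v

    uv≢inLooped : ∀ {t z} → IsUV t → InLooped z → t ≢ z
    uv≢inLooped t-uv iz = uv≢ t-uv (proj₁ iz) (inLooped≢v iz)

    oPart-arc : ∀ {a b} → a ≢ u → b ≢ u → a ≢ b → p a ≡ o → p b ≡ o → arc D a b ≡ false
    oPart-arc a≢u b≢u a≢b pa≡o pb≡o =
      trans (arc≡M p-part _ _ a≢u b≢u a≢b) (trans (cong₂ M pa≡o pb≡o) o-independent)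

    inO-arc : ∀ {a b} → InO a → InO b → a ≢ b → arc D a b ≡ false
    inO-arc (a≢u , _ , pa≡o) (b≢u , _ , pb≡o) a≢b = oPart-arc a≢u b≢u a≢b pa≡o pb≡o

    uv-inO-nonadjacent : ∀ {t z} → IsUV t → InO z → arc D t z ≡ false
    uv-inO-nonadjacent t-uv (z≢u , z≢v , pz≡o) =
      trans (uv-same (λ s → arc D s _) (proj₁ (uv-agree z≢u z≢v)) t-uv (inj₂ refl))
            (oPart-arc v≢u z≢u (≢-sym z≢v) pv≡o pz≡o)

    module WithinO {w} (w-inO : InO w) where

      r : Fin N → Fin m
      r = proj₁ (minimality w)

      r-part : IsMPartitionWithout M D w r
      r-part = proj₂ (minimality w)

      private
        inLooped≢w : ∀ {z} → InLooped z → z ≢ w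
        inLooped≢w (_ , pz≢o) refl = pz≢o (proj₂ (proj₂ w-inO))

        w≢u : w ≢ u
        w≢u = proj₁ w-inO

        w≢v : w ≢ v
        w≢v = proj₁ (proj₂ w-inO)

      inO-looped : ∀ {z} → InO z → z ≢ w → M (r z) (r z) ≡ true
      inO-looped iz@(z≢u , z≢v , pz≡o) z≢w =
        falseTwin-looped r-part (twins , inO-arc w-inO iz w≢z , inO-arc iz w-inO z≢w)
        where
        w≢z : w ≢ _
        w≢z = ≢-sym z≢w
        twins : Twins D w _
        twins = samePart-twins p-part v≢u w≢u z≢u w≢v z≢v w≢z (trans (proj₂ (proj₂ w-inO)) (sym pz≡o))
                  (uv-agree w≢u w≢v) (uv-agree z≢u z≢v)

      -- v stands in for w: both lie in the part o of p.
      inLooped-trueTwins : ∀ {x y} → InLooped x → InLooped y → x ≢ y → r x ≡ r y → M (r x) (r x) ≡ true →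
                           TrueTwins D x y
      inLooped-trueTwins ix iy x≢y rx≡ry looped =
        samePart-trueTwins r-part (≢-sym w≢v) (inLooped≢w ix) (inLooped≢w iy) (inLooped≢v ix) (inLooped≢v iy)
          x≢y rx≡ry looped
          (w-agrees-v ix) (w-agrees-v iy)
        where
        w-agrees-v : ∀ {z} → InLooped z → Agrees D z w v
        w-agrees-v iz = samePart-agrees p-part (proj₁ iz) w≢u v≢u (inLooped≢w iz) (inLooped≢v iz)
                          (trans (proj₂ (proj₂ w-inO)) (sym pv≡o))

      -- u and v are adjacent, so they cannot both lie in the independent part o of r.
      loopedTwin : Σ (Fin N) λ a → IsUV a × M (r a) (r a) ≡ true
      loopedTwin with M (r u) (r u) in ru-diag
      ... | true  = u , inj₁ refl , ru-diag
      ... | false = v , inj₂ refl ,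
                    adjacent-looped r-part (≢-sym w≢u) (≢-sym w≢v) u≢v (proj₁ (proj₂ uv-twins)) ru-diag

      a : Fin N
      a = proj₁ loopedTwin

      a-uv : IsUV a
      a-uv = proj₁ (proj₂ loopedTwin)

      a-looped : M (r a) (r a) ≡ true
      a-looped = proj₂ (proj₂ loopedTwin)

      partner : Fin N → Fin N
      partner z with follower? u p z
      ... | yes (t , _) = t
      ... | no _        = z

      partner-follows : ∀ {z} → Follower u p z → partner z < z × partner z ≢ u × p (partner z) ≡ p z
      partner-follows {z} follows with follower? u p z
      ... | yes (_ , t-precedes) = t-precedes
      ... | no leads             = ⊥-elim (leads follows)

      -- Of a follower z and its partner, rep z is one lying in a looped part of r.
      rep co : Fin N → Fin N
      rep z = if M (r z) (r z) then z else partner z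
      co  z = if M (r z) (r z) then partner z else z

      record RepresentedBy (z x x′ : Fin N) : Set where
        field
          rep-inLooped : InLooped x
          co-inLooped  : InLooped x′
          rep-part     : p x ≡ p z
          co-part      : p x′ ≡ p z
          rep-co-twins : TrueTwins D x x′
          rep-looped   : M (r x) (r x) ≡ true

      representative : ∀ {z} → InLooped z → Follower u p z → RepresentedBy z (rep z) (co z)
      representative {z} iz@(z≢u , pz≢o) follows = orient (M (r z) (r z)) refl
        where
        t : Fin N
        t = partner z
        t<z : t < z
        t<z = proj₁ (partner-follows follows)
        t≢u : t ≢ u
        t≢u = proj₁ (proj₂ (partner-follows follows))
        pt≡pz : p t ≡ p z
        pt≡pz = proj₂ (proj₂ (partner-follows follows))
        it : InLooped t
        it = t≢u , λ pt≡o → pz≢o (trans (sym pt≡pz) pt≡o)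
        zt-twins : TrueTwins D z t
        zt-twins = loopedPart-trueTwins p-part uv-twins z≢u t≢u (≢-sym (<⇒≢ t<z)) (sym pt≡pz) (≢o⇒looped pz≢o)
        orient : ∀ b → M (r z) (r z) ≡ b → RepresentedBy z (if b then z else t) (if b then t else z)
        orient true  rz-diag = record
          { rep-inLooped = iz ; co-inLooped = it ; rep-part = refl ; co-part = pt≡pz
          ; rep-co-twins = zt-twins ; rep-looped = rz-diag }
        orient false rz-diag = record
          { rep-inLooped = it ; co-inLooped = iz ; rep-part = pt≡pz ; co-part = refl
          ; rep-co-twins = trueTwins-sym D zt-twins
          ; rep-looped = adjacent-looped r-part (inLooped≢w iz) (inLooped≢w it) (proj₁ (proj₁ zt-twins))
                           (proj₁ (proj₂ zt-twins)) rz-diag }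

      private
        a≢w : a ≢ w
        a≢w = uv≢inO a-uv w-inO

      inO-part≢a : ∀ {z} → InO z → z ≢ w → r z ≢ r a
      inO-part≢a iz z≢w rz≡ra =
        not-¬ (trans (samePart-arc r-part a≢w z≢w (uv≢inO a-uv iz) (sym rz≡ra)) a-looped)
              (uv-inO-nonadjacent a-uv iz)

      inO-injective : ∀ {z z′} → InO z → InO z′ → z ≢ w → z′ ≢ w → r z ≡ r z′ → z ≡ z′
      inO-injective {z} {z′} iz iz′ z≢w z′≢w rz≡rz′ with z ≟ z′
      ... | yes z≡z′ = z≡z′
      ... | no z≢z′  = ⊥-elim (not-¬ (trans (samePart-arc r-part z≢w z′≢w z≢z′ rz≡rz′) (inO-looped iz z≢w))
                                     (inO-arc iz iz′ z≢z′))

      -- z sees x as v does (same part of p), and v sees x as it sees z (same part of r).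
      inO-part≢looped : ∀ {z x} → InO z → z ≢ w → InLooped x → r z ≢ r x
      inO-part≢looped {z} {x} iz@(z≢u , z≢v , pz≡o) z≢w ix rz≡rx = not-¬ z→x (begin
        arc D z x  ≡⟨ proj₁ (samePart-agrees p-part (proj₁ ix) z≢u v≢u x≢z (inLooped≢v ix) (trans pz≡o (sym pv≡o))) ⟩
        arc D v x  ≡⟨ proj₂ (samePart-agrees r-part (≢-sym w≢v) (inLooped≢w ix) z≢w (uv≢inLooped (inj₂ refl) ix)
                                                  (≢-sym z≢v) (sym rz≡rx)) ⟩
        arc D v z  ≡⟨ uv-inO-nonadjacent (inj₂ refl) iz ⟩
        false      ∎)
        where
        open ≡-Reasoning
        x≢z : x ≢ z
        x≢z refl = proj₂ ix pz≡o
        z→x : arc D z x ≡ true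
        z→x = trans (samePart-arc r-part z≢w (inLooped≢w ix) (≢-sym x≢z) rz≡rx) (inO-looped iz z≢w)

      -- In different parts of p, the representatives would be two adjacent common true twins of rep z.
      representatives-injective : ∀ {z z′} → InLooped z → Follower u p z → InLooped z′ → Follower u p z′ →
                                  r (rep z) ≡ r (rep z′) → z ≡ z′
      representatives-injective {z} {z′} iz follows iz′ follows′ parts≡ with p z ≟ p z′
      ... | yes pz≡pz′ = loopedFollowers-injective p-part uv-twins (proj₁ iz) (proj₁ iz′) follows follows′ pz≡pz′
                           (≢o⇒looped (proj₂ iz))
      ... | no pz≢pz′  = ⊥-elim (not-¬ co→rep′ (commonTrueTwin⇒nonadjacent (rep-co-twins R) rep-twins co≢rep′))
        where
        open RepresentedBy
        R : RepresentedBy z (rep z) (co z)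
        R  = representative iz follows
        R′ : RepresentedBy z′ (rep z′) (co z′)
        R′ = representative iz′ follows′
        rep≢rep′ : rep z ≢ rep z′
        rep≢rep′ e = pz≢pz′ (trans (sym (rep-part R)) (trans (cong p e) (rep-part R′)))
        co≢rep′ : co z ≢ rep z′
        co≢rep′ e = pz≢pz′ (trans (sym (co-part R)) (trans (cong p e) (rep-part R′)))
        rep-twins : TrueTwins D (rep z) (rep z′)
        rep-twins = inLooped-trueTwins (rep-inLooped R) (rep-inLooped R′) rep≢rep′ parts≡ (rep-looped R)
        co→rep′ : arc D (co z) (rep z′) ≡ true
        co→rep′ = trans (sym (proj₁ (twins⇒agrees D (proj₁ (rep-co-twins R)) (≢-sym rep≢rep′) (≢-sym co≢rep′))))
                        (proj₁ (proj₂ rep-twins))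

      Collision : Fin N → Set
      Collision z = InLooped z × Follower u p z × r (rep z) ≡ r a

      collision? : ∀ z → Dec (Collision z)
      collision? z = (¬? (z ≟ u) ×-dec ¬? (p z ≟ o)) ×-dec follower? u p z ×-dec (r (rep z) ≟ r a)

      -- Left vertices are coded by looped parts of r (u by o), Right ones by parts of p (v by o).
      data Left (z : Fin N) : Set where
        left-u        : z ≡ u → Left z
        left-w        : z ≡ w → Left z
        left-inO      : InO z → z ≢ w → Left z
        left-follower : InLooped z → Follower u p z → Left z

      data Right (z : Fin N) : Set where
        right-v      : z ≡ v → Right z
        right-leader : InLooped z → ¬ Follower u p z → Right z

      classify : ∀ z → Left z ⊎ Right z
      classify z with z ≟ u | z ≟ v | p z ≟ o | z ≟ w | follower? u p z
      ... | yes z≡u | _       | _        | _       | _           = inj₁ (left-u z≡u)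
      ... | no _    | yes z≡v | _        | _       | _           = inj₂ (right-v z≡v)
      ... | no _    | no _    | yes _    | yes z≡w | _           = inj₁ (left-w z≡w)
      ... | no z≢u  | no z≢v  | yes pz≡o | no z≢w  | _           = inj₁ (left-inO (z≢u , z≢v , pz≡o) z≢w)
      ... | no z≢u  | no _    | no pz≢o  | _       | yes follows = inj₁ (left-follower (z≢u , pz≢o) follows)
      ... | no z≢u  | no _    | no pz≢o  | _       | no leads    = inj₂ (right-leader (z≢u , pz≢o) leads)

      left-part : ∀ {z} → Left z → Fin m
      left-part     (left-u _)          = o
      left-part     (left-w _)          = r a
      left-part {z} (left-inO _ _)      = r z
      left-part {z} (left-follower _ _) = r (rep z)

      right-part : ∀ {z} → Right z → Fin m
      right-part     (right-v _)        = o
      right-part {z} (right-leader _ _) = p z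

      right-injective : ∀ {z z′} (α : Right z) (β : Right z′) → right-part α ≡ right-part β → z ≡ z′
      right-injective (right-v refl)          (right-v refl)            _ = refl
      right-injective (right-v _)             (right-leader iz _)       e = ⊥-elim (proj₂ iz (sym e))
      right-injective (right-leader iz _)     (right-v _)               e = ⊥-elim (proj₂ iz e)
      right-injective (right-leader iz leads) (right-leader iz′ leads′) e =
        leaders-injective (proj₁ iz) (proj₁ iz′) leads leads′ e

      left-injective : (∀ z → ¬ Collision z) →
                       ∀ {z z′} (α : Left z) (β : Left z′) → left-part α ≡ left-part β → z ≡ z′
      left-injective _  (left-u refl)          (left-u refl)          _ = refl
      left-injective _  (left-u _)             (left-w _)             e = ⊥-elim (looped≢o a-looped (sym e))
      left-injective _  (left-u _)             (left-inO iz z≢w)      e = ⊥-elim (looped≢o (inO-looped iz z≢w) (sym e))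
      left-injective _  (left-u _)             (left-follower iz fol) e =
        ⊥-elim (looped≢o (RepresentedBy.rep-looped (representative iz fol)) (sym e))
      left-injective _  (left-w _)             (left-u _)             e = ⊥-elim (looped≢o a-looped e)
      left-injective _  (left-w refl)          (left-w refl)          _ = refl
      left-injective _  (left-w _)             (left-inO iz z≢w)      e = ⊥-elim (inO-part≢a iz z≢w (sym e))
      left-injective nc (left-w _)             (left-follower iz fol) e = ⊥-elim (nc _ (iz , fol , sym e))
      left-injective _  (left-inO iz z≢w)      (left-u _)             e = ⊥-elim (looped≢o (inO-looped iz z≢w) e)
      left-injective _  (left-inO iz z≢w)      (left-w _)             e = ⊥-elim (inO-part≢a iz z≢w e)
      left-injective _  (left-inO iz z≢w)      (left-inO iz′ z′≢w)    e = inO-injective iz iz′ z≢w z′≢w e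
      left-injective _  (left-inO iz z≢w)      (left-follower ix fol) e =
        ⊥-elim (inO-part≢looped iz z≢w (RepresentedBy.rep-inLooped (representative ix fol)) e)
      left-injective _  (left-follower iz fol) (left-u _)             e =
        ⊥-elim (looped≢o (RepresentedBy.rep-looped (representative iz fol)) e)
      left-injective nc (left-follower iz fol) (left-w _)             e = ⊥-elim (nc _ (iz , fol , e))
      left-injective _  (left-follower ix fol) (left-inO iz z≢w)      e =
        ⊥-elim (inO-part≢looped iz z≢w (RepresentedBy.rep-inLooped (representative ix fol)) (sym e))
      left-injective _  (left-follower iz fol) (left-follower iz′ fol′) e = representatives-injective iz fol iz′ fol′ e

      ≤-withoutCollision : (∀ z → ¬ Collision z) → N ≤ m + m
      ≤-withoutCollision no-collision =
        ≤-fromClassification Left Right classify left-part right-part (left-injective no-collision) right-injective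

      -- For x = rep z and its twin x′ = co z, x′ is the only vertex of o in a partition q of D − x:
      -- from a, another vertex y of o looks like x′, hence like x, so a → y; but a sees y as x does (r),
      -- and x sees y as x′ does, which is not adjacent to y.
      module Collided {z} (collision : Collision z) where

        open RepresentedBy (representative (proj₁ collision) (proj₁ (proj₂ collision)))
        open ≡-Reasoning

        x x′ : Fin N
        x  = rep z
        x′ = co z

        q : Fin N → Fin m
        q = proj₁ (minimality x)

        q-part : IsMPartitionWithout M D x q
        q-part = proj₂ (minimality x)

        private
          rx≡ra : r x ≡ r a
          rx≡ra = proj₂ (proj₂ collision)

          x′≢x : x′ ≢ x
          x′≢x = ≢-sym (proj₁ (proj₁ rep-co-twins))

          x≢w : x ≢ w
          x≢w = inLooped≢w rep-inLooped

          a≢x : a ≢ x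
          a≢x = uv≢inLooped a-uv rep-inLooped

          a≢x′ : a ≢ x′
          a≢x′ = uv≢inLooped a-uv co-inLooped

          qx′≡o : q x′ ≡ o
          qx′≡o = trueTwin-part q-part rep-co-twins

          xx′-agree : ∀ {y} → y ≢ x → y ≢ x′ → Agrees D y x x′
          xx′-agree = twins⇒agrees D (proj₁ rep-co-twins)

        a→x : arc D a x ≡ true
        a→x = trans (samePart-arc r-part a≢w x≢w a≢x (sym rx≡ra)) a-looped

        uv→x′ : ∀ {y} → IsUV y → y ≢ x → y ≢ x′ → arc D y x′ ≡ true
        uv→x′ {y} y-uv y≢x y≢x′ = begin
          arc D y x′  ≡⟨ sym (proj₂ (xx′-agree y≢x y≢x′)) ⟩
          arc D y x   ≡⟨ uv-same (λ s → arc D s x) (proj₁ (uv-agree (proj₁ rep-inLooped) (inLooped≢v rep-inLooped)))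
                               y-uv a-uv ⟩
          arc D a x   ≡⟨ a→x ⟩
          true        ∎

        a→o : ∀ {y} → y ≢ x → y ≢ x′ → a ≢ y → q y ≡ o → arc D a y ≡ true
        a→o {y} y≢x y≢x′ a≢y qy≡o = begin
          arc D a y   ≡⟨ proj₂ (samePart-agrees q-part a≢x y≢x x′≢x a≢y a≢x′ (trans qy≡o (sym qx′≡o))) ⟩
          arc D a x′  ≡⟨ sym (proj₂ (xx′-agree a≢x a≢x′)) ⟩
          arc D a x   ≡⟨ a→x ⟩
          true        ∎

        o-arc : ∀ {b c} → b ≢ x → c ≢ x → b ≢ c → q b ≡ o → q c ≡ o → arc D b c ≡ false
        o-arc b≢x c≢x b≢c qb≡o qc≡o =
          trans (arc≡M q-part _ _ b≢x c≢x b≢c) (trans (cong₂ M qb≡o qc≡o) o-independent)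

        only-x′-in-o : ∀ y → y ≢ x → y ≢ x′ → q y ≢ o
        only-x′-in-o y y≢x y≢x′ qy≡o with y ≟ u | y ≟ v | y ≟ w
        ... | yes y≡u | _       | _        = not-¬ (uv→x′ (inj₁ y≡u) y≢x y≢x′) (o-arc y≢x x′≢x y≢x′ qy≡o qx′≡o)
        ... | no _    | yes y≡v | _        = not-¬ (uv→x′ (inj₂ y≡v) y≢x y≢x′) (o-arc y≢x x′≢x y≢x′ qy≡o qx′≡o)
        ... | no _    | no _    | yes refl = not-¬ (a→o y≢x y≢x′ a≢w qy≡o) (uv-inO-nonadjacent a-uv w-inO)
        ... | no y≢u  | no y≢v  | no y≢w   = not-¬ (a→o y≢x y≢x′ a≢y qy≡o) (begin
          arc D a y   ≡⟨ proj₁ (samePart-agrees r-part y≢w a≢w x≢w (≢-sym a≢y) y≢x (sym rx≡ra)) ⟩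
          arc D x y   ≡⟨ proj₁ (xx′-agree y≢x y≢x′) ⟩
          arc D x′ y  ≡⟨ o-arc x′≢x y≢x (≢-sym y≢x′) qx′≡o qy≡o ⟩
          false       ∎)
          where
          a≢y : a ≢ y
          a≢y = uv≢ a-uv y≢u y≢v

        bound : N ≤ m + m
        bound = ≤-fromTrueTwins q-part rep-co-twins only-x′-in-o

      bound : N ≤ m + m
      bound with any? collision?
      ... | yes (_ , collision) = Collided.bound collision
      ... | no no-collision     = ≤-withoutCollision λ z collision → no-collision (z , collision)

    bound : N ≤ m + m
    bound with any? inO?
    ... | yes (_ , w-inO) = WithinO.bound w-inO
    ... | no none         = ≤-fromTrueTwins p-part uv-twins λ z z≢u z≢v pz≡o → none (z , z≢u , z≢v , pz≡o)

complement : Digraph n → Digraph n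
complement D = record
  { arc      = λ a b → if does (a ≟ b) then false else not (arc D a b)
  ; loopless = λ a → cong (λ c → if c then false else not (arc D a a)) (dec-true (a ≟ a) refl)
  }

complement-arc : ∀ (D : Digraph n) {a b} → a ≢ b → arc (complement D) a b ≡ not (arc D a b)
complement-arc D {a} {b} a≢b = cong (λ c → if c then false else not (arc D a b)) (dec-false (a ≟ b) a≢b)

complementᴹ : Matrix m → Matrix m
complementᴹ M i j = not (M i j)

diagOnes-complementᴹ : ∀ (M : Matrix m) → diagOnes (complementᴹ M) ≡ diagZeros M
diagOnes-complementᴹ M = countFin-not (λ i → M i i) true

diagZeros-complementᴹ : ∀ (M : Matrix m) → diagZeros (complementᴹ M) ≡ diagOnes M
diagZeros-complementᴹ M = countFin-not (λ i → M i i) false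

module _ (M : Matrix m) (D D′ : Digraph n) (complementary : ∀ {a b} → a ≢ b → arc D′ a b ≡ not (arc D a b)) where

  complement-hasPartition : HasMPartition M D → HasMPartition (complementᴹ M) D′
  complement-hasPartition (p , p-part) = p , λ a b a≢b → trans (complementary a≢b) (cong not (p-part a b a≢b))

  complement-hasPartition⁻ : HasMPartition (complementᴹ M) D′ → HasMPartition M D
  complement-hasPartition⁻ (p , p-part) =
    p , λ a b a≢b → not-injective (trans (sym (complementary a≢b)) (p-part a b a≢b))

complement-minimalObstruction : ∀ {M : Matrix m} {D : Digraph n} → MinimalObstruction M D →
                                MinimalObstruction (complementᴹ M) (complement D)
complement-minimalObstruction {n = zero}  {M} {D} no-partition =
  no-partition ∘ complement-hasPartition⁻ M D (complement D) (complement-arc D)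
complement-minimalObstruction {n = suc n} {M} {D} (no-partition , minimal) =
  no-partition ∘ complement-hasPartition⁻ M D (complement D) (complement-arc D) ,
  λ v → complement-hasPartition M (deleteVertex D v) (deleteVertex (complement D) v)
          (λ {a} {b} a≢b → complement-arc D (a≢b ∘ punchIn-injective v a b)) (minimal v)

falseTwins⇒trueTwins-complement : ∀ {D : Digraph n} {u v} → FalseTwins D u v → TrueTwins (complement D) u v
falseTwins⇒trueTwins-complement {D = D} (twins@(u≢v , _) , uv , vu) =
  agrees⇒twins (complement D) u≢v agree ,
  trans (complement-arc D u≢v) (cong not uv) , trans (complement-arc D (≢-sym u≢v)) (cong not vu)
  where
  agree : ∀ t → t ≢ _ → t ≢ _ → Agrees (complement D) t _ _
  agree t t≢u t≢v =
    trans (complement-arc D (≢-sym t≢u)) (trans (cong not (proj₁ agrees)) (sym (complement-arc D (≢-sym t≢v)))) ,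
    trans (complement-arc D t≢u) (trans (cong not (proj₂ agrees)) (sym (complement-arc D t≢v)))
    where
    agrees : Agrees D t _ _
    agrees = twins⇒agrees D twins t≢u t≢v

trueTwins-bound : ∀ (M : Matrix m) (D : Digraph n) → MinimalObstruction M D → diagZeros M ≡ 1 →
                  (∃[ u ] ∃[ v ] TrueTwins D u v) → n ≤ 2 * (diagOnes M + 1)
trueTwins-bound {n = zero} M D _ _ (() , _)
trueTwins-bound {m} {suc n} M D (no-partition , minimal) one-zero (_ , _ , uv-twins) =
  ≤-trans (TwinPair.bound uv-twins) (≤-reflexive (begin
    m + m                           ≡⟨ cong (m +_) (sym (+-identityʳ m)) ⟩
    2 * m                           ≡⟨ cong (2 *_) (sym (countFin-total (λ i → M i i))) ⟩
    2 * (diagOnes M + diagZeros M)  ≡⟨ cong (λ k → 2 * (diagOnes M + k)) one-zero ⟩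
    2 * (diagOnes M + 1)            ∎))
  where
  open ≡-Reasoning
  unique-zero : Σ (Fin m) λ i → M i i ≡ false × (∀ j → M j j ≡ false → j ≡ i)
  unique-zero = countFin-one (λ i → M i i) false one-zero
  o : Fin m
  o = proj₁ unique-zero
  open OneIndependentPart M D no-partition (λ x → partitionWithout o (minimal x))
         o (proj₁ (proj₂ unique-zero)) (proj₂ (proj₂ unique-zero))

lemma9 : ∀ {m n} (M : Matrix m) (D : Digraph n) → MinimalObstruction M D →
    (diagZeros M ≡ 1 → (∃[ u ] ∃[ v ] TrueTwins D u v) → n ≤ 2 * (diagOnes M + 1))
    × (diagOnes M ≡ 1 → (∃[ u ] ∃[ v ] FalseTwins D u v) → n ≤ 2 * (diagZeros M + 1))
lemma9 M D obstruction =
  trueTwins-bound M D obstruction ,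
  λ one-one (u , v , uv-twins) →
    subst (λ k → _ ≤ 2 * (k + 1)) (diagOnes-complementᴹ M)
      (trueTwins-bound (complementᴹ M) (complement D) (complement-minimalObstruction obstruction)
        (trans (diagZeros-complementᴹ M) one-one)
        (u , v , falseTwins⇒trueTwins-complement {D = D} uv-twins))
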